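{- Let $A$ be a set and $F=\mathcal{P}^A$. The order on $F$ given by $\alpha\sqsubseteq_X\beta$ iff $\alpha(a)\supseteq\beta(a)$ for all $a\in A$ (the order defining anti-simulations) is stable.
   Context: $\mathcal{P}$ is the covariant powerset functor ($\mathcal{P}f$ = direct image) and $F=\mathcal{P}^A$ maps $X$ to $(\mathcal{P}X)^A$ with $Ff(\alpha)(a)=f(\alpha(a))$. For a relation $R\subseteq X_1\times X_2$ with projections $r_1,r_2$, $\mathrm{Rel}(F)(R)=\{(u,v)\mid\exists w\in F(R).\,Fr_1(w)=u,\ Fr_2(w)=v\}$ and $\mathrm{Rel}_{\sqsubseteq}(F)(R)=\{(u,v)\mid\exists w\in F(R).\,u\sqsubseteq_{X_1}Fr_1(w)\wedge Fr_2(w)\sqsubseteq_{X_2}v\}$. An order $\sqsubseteq$ on $F$ is stable if for all $f:X\to Z$, $g:Y\to W$ and $R\subseteq Z\times W$: $\mathrm{Rel}_{\sqsubseteq}(F)((f\times g)^{ -1}(R))=(Ff\times Fg)^{ -1}(\mathrm{Rel}_{\sqsubseteq}(F)(R))$. -}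

module Defs where

open import Level using (Level; suc; _⊔_)
open import Data.Product using (Σ; _×_; _,_; proj₁; proj₂; ∃)
open import Relation.Binary.PropositionalEquality using (_≡_)
open import Function.Bundles using (_⇔_)

Pow : Set → Set₁
Pow X = X → Set

_⊆_ : {X : Set} → Pow X → Pow X → Set
S ⊆ T = ∀ x → S x → T x

Pmap : {X Y : Set} → (X → Y) → Pow X → Pow Y
Pmap f S y = ∃ λ x → S x × f x ≡ y

F : Set → Set → Set₁
F A X = A → Pow X

Fmap : {A X Y : Set} → (X → Y) → F A X → F A Y
Fmap f α a = Pmap f (α a)

BRel : Set → Set → Set₁
BRel X₁ X₂ = X₁ → X₂ → Set

BRel₁ : Set₁ → Set₁ → Set₂
BRel₁ U V = U → V → Set₁

Graph : {X₁ X₂ : Set} → BRel X₁ X₂ → Set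
Graph {X₁} {X₂} R = Σ (X₁ × X₂) λ p → R (proj₁ p) (proj₂ p)

r₁ : {X₁ X₂ : Set} {R : BRel X₁ X₂} → Graph R → X₁
r₁ ((x , _) , _) = x

r₂ : {X₁ X₂ : Set} {R : BRel X₁ X₂} → Graph R → X₂
r₂ ((_ , y) , _) = y

FOrder : Set → Set₁
FOrder A = (X : Set) → F A X → F A X → Set

Rel⊑ : {A : Set} → FOrder A → {X₁ X₂ : Set} → BRel X₁ X₂ → BRel₁ (F A X₁) (F A X₂)
Rel⊑ {A} ord {X₁} {X₂} R u v =
  Σ (F A (Graph R)) λ w → ord X₁ u (Fmap r₁ w) × ord X₂ (Fmap r₂ w) v

preimage : {X Y Z W : Set} → (X → Z) → (Y → W) → BRel Z W → BRel X Y
preimage f g R x y = R (f x) (g y)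

preimage₁ : {U V U' V' : Set₁} → (U → U') → (V → V') → BRel₁ U' V' → BRel₁ U V
preimage₁ f g S u v = S (f u) (g v)

_≐_ : {U V : Set₁} → BRel₁ U V → BRel₁ U V → Set₁
S ≐ T = ∀ u v → S u v ⇔ T u v

Stable : {A : Set} → FOrder A → Set₁
Stable {A} ord =
  {X Y Z W : Set} (f : X → Z) (g : Y → W) (R : BRel Z W) →
  Rel⊑ ord (preimage f g R) ≐ preimage₁ (Fmap f) (Fmap g) (Rel⊑ ord R)

antiOrder : (A : Set) → FOrder A
antiOrder A X α β = (a : A) → β a ⊆ α a

{-# OPTIONS --safe #-}
-- For the anti-simulation order, Rel⊑(F)(R) relates u and v exactly when
-- every a-successor in v is R-related to some a-successor in u (the Smyth
-- half of the Egli–Milner lifting); conversely such a pair is witnessed by the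
-- set of all pairs of R whose first component lies in u. That condition is
-- first-order in the elements, so it visibly commutes with taking preimages.
module Submission where

open import Defs
open import Data.Product using (_×_; _,_; ∃)
open import Relation.Binary.PropositionalEquality using (refl)
open import Function.Bundles using (_⇔_; mk⇔)
open import Function.Construct.Composition using (_⇔-∘_)
open import Function.Construct.Symmetry using (⇔-sym)

Smyth : {A X₁ X₂ : Set} → BRel X₁ X₂ → F A X₁ → F A X₂ → Set
Smyth R u v = ∀ a y → v a y → ∃ λ x → u a x × R x y

Rel⊑-antiOrder⇔Smyth : {A X₁ X₂ : Set} (R : BRel X₁ X₂) (u : F A X₁) (v : F A X₂) →
                       Rel⊑ (antiOrder A) R u v ⇔ Smyth R u v
Rel⊑-antiOrder⇔Smyth {A} R u v = mk⇔ to from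
  where
  to : Rel⊑ (antiOrder A) R u v → Smyth R u v
  to (w , r₁[w]⊆u , v⊆r₂[w]) a y vy with v⊆r₂[w] a y vy
  ... | ((x , _) , xRy) , wxy , refl = x , r₁[w]⊆u a x (_ , wxy , refl) , xRy

  from : Smyth R u v → Rel⊑ (antiOrder A) R u v
  from smyth = w , r₁[w]⊆u , v⊆r₂[w]
    where
    w : F A (Graph R)
    w a ((x , _) , _) = u a x

    r₁[w]⊆u : (a : A) → Fmap r₁ w a ⊆ u a
    r₁[w]⊆u a x (_ , ux , refl) = ux

    v⊆r₂[w] : (a : A) → v a ⊆ Fmap r₂ w a
    v⊆r₂[w] a y vy with smyth a y vy
    ... | x , ux , xRy = ((x , y) , xRy) , ux , refl

Smyth-preimage : {A X Y Z W : Set} (f : X → Z) (g : Y → W) (R : BRel Z W)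
                 (u : F A X) (v : F A Y) →
                 Smyth (preimage f g R) u v ⇔ Smyth R (Fmap f u) (Fmap g v)
Smyth-preimage f g R u v = mk⇔ to from
  where
  to : Smyth (preimage f g R) u v → Smyth R (Fmap f u) (Fmap g v)
  to smyth a _ (y , vy , refl) with smyth a y vy
  ... | x , ux , fxRgy = f x , (x , ux , refl) , fxRgy

  from : Smyth R (Fmap f u) (Fmap g v) → Smyth (preimage f g R) u v
  from smyth a y vy with smyth a (g y) (y , vy , refl)
  ... | _ , (x , ux , refl) , fxRgy = x , ux , fxRgy

corollary2 : (A : Set) → Stable (antiOrder A)
corollary2 A f g R u v =
  ⇔-sym (Rel⊑-antiOrder⇔Smyth R (Fmap f u) (Fmap g v))
    ⇔-∘ (Smyth-preimage f g R u v ⇔-∘ Rel⊑-antiOrder⇔Smyth (preimage f g R) u v)
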